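{- Let $\Gamma$ be a triangulation of a connected closed $2$-dimensional surface $M$ and let $F$ be a face of $\Gamma$ whose $z$-monodromy $M_F$ is of type (M6), i.e. $M_F=(-e_1,e_3,e_2)(-e_2,-e_3,e_1)$ where $(e_1,e_2,e_3)$ is one of the two cycles of $D_F$. Then $F$ is of type I with respect to every $z$-orientation of $\Gamma$.
   Context: A triangulation $\Gamma$ of $M$ is a $2$-cell embedding of a connected simple finite graph in $M$ all of whose faces are triangles; every edge lies in exactly two distinct faces and two distinct faces meet in an edge, a vertex, or not at all. A zigzag in $\Gamma$ is a sequence of edges $(e_i)_{i\in\mathbb N}$ such that for every $i$: $e_i$ and $e_{i+1}$ are distinct edges of some face; the faces containing $e_i,e_{i+1}$ and $e_{i+1},e_{i+2}$ are distinct; and $e_i$, $e_{i+2}$ have no common vertex. A zigzag is periodic and regarded as a cyclic sequence; its reverse $Z^{ -1}$ is also a zigzag and $Z\neq Z^{ -1}$. A zigzag traverses each of its edges $e_i$ in a direction: from the common vertex of $e_{i-1},e_i$ to the common vertex of $e_i,e_{i+1}$; thus a zigzag can be viewed as a cyclic sequence of oriented edges, and any two consecutive oriented edges of a face determine a unique zigzag containing them consecutively. If $\Gamma$ has exactly $k$ zigzags up to reversal, a $z$-orientation $\tau$ is a set of $k$ zigzags containing exactly one of $Z,Z^{ -1}$ for each zigzag $Z$. Each edge $e$ then occurs exactly twice in total among the zigzags of $\tau$; $e$ is of type I if these two occurrences traverse $e$ in opposite directions and of type II if in the same direction. A face is of type I if it contains exactly two edges of type I and one edge of type II. For a face $F$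 with vertices $a,b,c$, let $\Omega(F)=\{ab,bc,ca,ac,cb,ba\}$ be its set of oriented edges ($xy$ is the edge from $x$ to $y$, and $-xy:=yx$), and $D_F=(ab,bc,ca)(ac,cb,ba)$, a permutation of $\Omega(F)$. The $z$-monodromy $M_F$ of $F$ is the permutation of $\Omega(F)$ defined by: for $e\in\Omega(F)$ take $e_0\in\Omega(F)$ with $D_F(e_0)=e$, consider the zigzag containing the consecutive oriented edges $e_0,e$, and let $M_F(e)$ be the first element of $\Omega(F)$ occurring in this zigzag after $e$. -}

module Defs where

open import Data.Nat using (ℕ)
open import Data.Fin using (Fin)
open import Data.Bool using (Bool; true; not)
open import Data.Product using (Σ; ∃; _×_; _,_; proj₁; proj₂)
open import Data.Sum using (_⊎_)
open import Relation.Nullary using (¬_)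
open import Relation.Binary.PropositionalEquality using (_≡_; _≢_)
open import Relation.Binary.Construct.Closure.ReflexiveTransitive using (Star)

record Triangulation : Set where
  field
    n    : ℕ
    m    : ℕ
    face : Fin m → Fin n × Fin n × Fin n

module _ (Γ : Triangulation) where
  open Triangulation Γ

  _∈F_ : Fin n → Fin m → Set
  x ∈F i with face i
  ... | (p , q , r) = x ≡ p ⊎ x ≡ q ⊎ x ≡ r

  FaceVerts : Fin m → Fin n → Fin n → Fin n → Set
  FaceVerts i a b c = a ≢ b × b ≢ c × a ≢ c × a ∈F i × b ∈F i × c ∈F i

  Adj : Fin n → Fin n → Set
  Adj x y = x ≢ y × Σ (Fin m) λ i → x ∈F i × y ∈F i

  LinkAdj : Fin n → Fin m → Fin m → Set
  LinkAdj v i j = Σ (Fin n) λ u → u ≢ v × u ∈F i × u ∈F j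

  record IsTriangulation : Set where
    field
      face-distinct : ∀ i → let (p , q , r) = face i in p ≢ q × q ≢ r × p ≢ r
      faces-distinct : ∀ i j → (∀ x → x ∈F i → x ∈F j) → i ≡ j
      edge-two-faces : ∀ i x y → x ≢ y → x ∈F i → y ∈F i →
        Σ (Fin m) λ j → i ≢ j × x ∈F j × y ∈F j ×
          (∀ k → x ∈F k → y ∈F k → k ≡ i ⊎ k ≡ j)
      vertex-covered : ∀ x → Σ (Fin m) λ i → x ∈F i
      -- the graph is connected (so M is connected)
      connected : ∀ x y → Star Adj x y
      -- the link of every vertex is a single cycle (M is a closed surface)
      link-connected : ∀ v i j → v ∈F i → v ∈F j → Star (LinkAdj v) i j

  -- A "state" (x , y , z) with {x,y,z} a face stands for two
  -- consecutive oriented edges x→y , y→z of a zigzag.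

  Flag : Fin n → Fin n → Fin n → Set
  Flag x y z = Σ (Fin m) λ i → FaceVerts i x y z

  Next : Fin n × Fin n × Fin n → Fin n × Fin n × Fin n → Set
  Next (x , y , z) (y' , z' , w) =
    y' ≡ y × z' ≡ z × Flag x y z × Flag y z w × w ≢ x

  snd-edge : Fin n × Fin n × Fin n → Fin n × Fin n
  snd-edge (x , y , z) = (y , z)

  InΩ : Fin m → Fin n × Fin n → Set
  InΩ i (v , w) = v ∈F i × w ∈F i

  data Reach (i : Fin m) : Fin n × Fin n × Fin n → Fin n × Fin n → Set where
    stop : ∀ {s s'} → Next s s' → InΩ i (snd-edge s') → Reach i s (snd-edge s')
    step : ∀ {s s' e} → Next s s' → ¬ InΩ i (snd-edge s') → Reach i s' e → Reach i s e

  -- z-monodromy: for F = face i with vertices x , y , z,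
  -- M_F (x→y) = e.  Here D_F⁻¹(x→y) = z→x, so the zigzag is the one
  -- through the consecutive oriented edges z→x , x→y.
  Monodromy : Fin m → Fin n → Fin n → Fin n → Fin n × Fin n → Set
  Monodromy i x y z e = Reach i (z , x , y) e

  -- M_F is of type (M6):
  -- M_F = (-e₁ , e₃ , e₂)(-e₂ , -e₃ , e₁) with (e₁,e₂,e₃) = (ab,bc,ca)
  -- for some ordering a , b , c of the vertices of F (this ordering
  -- ranges over both cycles of D_F).
  IsM6 : Fin m → Set
  IsM6 i = Σ (Fin n) λ a → Σ (Fin n) λ b → Σ (Fin n) λ c →
    FaceVerts i a b c ×
    Monodromy i b a c (c , a) ×   -- -e₁ ↦ e₃
    Monodromy i c a b (b , c) ×   --  e₃ ↦ e₂
    Monodromy i b c a (b , a) ×   --  e₂ ↦ -e₁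
    Monodromy i c b a (a , c) ×   -- -e₂ ↦ -e₃
    Monodromy i a c b (a , b) ×   -- -e₃ ↦ e₁
    Monodromy i a b c (c , b)     --  e₁ ↦ -e₂

  -- z-orientations: a choice τ of one zigzag from each pair {Z , Z⁻¹},
  -- encoded as a Boolean on states: true = the zigzag through this state
  -- is chosen.

  record ZOrientation : Set where
    field
      τ : Fin n → Fin n → Fin n → Bool
      τ-next : ∀ x y z w → Next (x , y , z) (y , z , w) → τ x y z ≡ τ y z w
      τ-rev  : ∀ x y z → Flag x y z → τ z y x ≡ not (τ x y z)

  open ZOrientation

  -- edge {a,b} is of type I w.r.t. τ: its two occurrences in the chosen
  -- zigzags traverse it in opposite directions (one as a→b, one as b→a)
  EdgeTypeI : ZOrientation → Fin n → Fin n → Set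
  EdgeTypeI t a b = Σ (Fin n) λ z → Σ (Fin n) λ z' →
    Flag a b z × Flag b a z' × τ t a b z ≡ true × τ t b a z' ≡ true

  FaceTypeI : ZOrientation → Fin m → Set
  FaceTypeI t i with face i
  ... | (a , b , c) =
    (EdgeTypeI t a b × EdgeTypeI t b c × ¬ EdgeTypeI t c a) ⊎
    (EdgeTypeI t b c × EdgeTypeI t c a × ¬ EdgeTypeI t a b) ⊎
    (EdgeTypeI t c a × EdgeTypeI t a b × ¬ EdgeTypeI t b c)

-- For a face with vertices x y z, the edge x y is of type I exactly when τ differs on the
-- zigzags through (x , y , z) and (z , x , y), the two zigzags traversing x → y.  Writing
-- α β γ for τ at (a , b , c), (b , c , a), (c , a , b), the edges a b, b c, c a are of type I
-- iff α ≠ γ, β ≠ α, γ ≠ β; for Booleans an even number of these hold.  The arrow -e₁ ↦ e₃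
-- of (M6) says that the zigzag through c → b → a next returns to F along c → a, so it also
-- passes through (c , a , b); with τ-reversal this gives γ = not α, so a b is of type I and
-- therefore exactly two edges are.
module Submission where

open import Defs
open import Data.Fin using (Fin; _≟_)
open import Data.Bool using (Bool; true; false; not)
open import Data.Bool.Properties using (not-¬; ¬-not) renaming (_≟_ to _≟ᵇ_)
open import Data.Product using (Σ; _×_; _,_)
open import Data.Sum using (_⊎_; inj₁; inj₂)
open import Data.Empty using (⊥-elim)
open import Relation.Nullary using (¬_; yes; no)
open import Relation.Binary.Definitions using (Symmetric)
open import Relation.Binary.PropositionalEquality

module _ {A : Set} where

  _∈₃_ : A → A × A × A → Set
  x ∈₃ (p , q , r) = x ≡ p ⊎ x ≡ q ⊎ x ≡ r

  ∈₃-⊆ : ∀ {x y z u t} → x ∈₃ t → y ∈₃ t → z ∈₃ t → u ∈₃ (x , y , z) → u ∈₃ t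
  ∈₃-⊆ x∈t _ _ (inj₁ refl) = x∈t
  ∈₃-⊆ _ y∈t _ (inj₂ (inj₁ refl)) = y∈t
  ∈₃-⊆ _ _ z∈t (inj₂ (inj₂ refl)) = z∈t

  third-element : ∀ {p q r x y} → p ≢ q → q ≢ r → p ≢ r → x ≢ y →
    x ∈₃ (p , q , r) → y ∈₃ (p , q , r) →
    Σ A λ d → d ∈₃ (p , q , r) × x ≢ d × y ≢ d ×
      (∀ {u} → u ∈₃ (p , q , r) → u ∈₃ (x , y , d))
  third-element _ _ _ x≢y (inj₁ refl) (inj₁ refl) = ⊥-elim (x≢y refl)
  third-element _ _ _ x≢y (inj₂ (inj₁ refl)) (inj₂ (inj₁ refl)) = ⊥-elim (x≢y refl)
  third-element _ _ _ x≢y (inj₂ (inj₂ refl)) (inj₂ (inj₂ refl)) = ⊥-elim (x≢y refl)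
  third-element _ q≢r p≢r _ (inj₁ refl) (inj₂ (inj₁ refl)) =
    _ , inj₂ (inj₂ refl) , p≢r , q≢r , λ u∈ → u∈
  third-element _ q≢r p≢r _ (inj₂ (inj₁ refl)) (inj₁ refl) =
    _ , inj₂ (inj₂ refl) , q≢r , p≢r ,
    λ { (inj₁ e) → inj₂ (inj₁ e) ; (inj₂ (inj₁ e)) → inj₁ e ; (inj₂ (inj₂ e)) → inj₂ (inj₂ e) }
  third-element p≢q q≢r _ _ (inj₁ refl) (inj₂ (inj₂ refl)) =
    _ , inj₂ (inj₁ refl) , p≢q , ≢-sym q≢r ,
    λ { (inj₁ e) → inj₁ e ; (inj₂ (inj₁ e)) → inj₂ (inj₂ e) ; (inj₂ (inj₂ e)) → inj₂ (inj₁ e) }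
  third-element p≢q q≢r _ _ (inj₂ (inj₂ refl)) (inj₁ refl) =
    _ , inj₂ (inj₁ refl) , ≢-sym q≢r , p≢q ,
    λ { (inj₁ e) → inj₂ (inj₁ e) ; (inj₂ (inj₁ e)) → inj₂ (inj₂ e) ; (inj₂ (inj₂ e)) → inj₁ e }
  third-element p≢q _ p≢r _ (inj₂ (inj₁ refl)) (inj₂ (inj₂ refl)) =
    _ , inj₁ refl , ≢-sym p≢q , ≢-sym p≢r ,
    λ { (inj₁ e) → inj₂ (inj₂ e) ; (inj₂ (inj₁ e)) → inj₁ e ; (inj₂ (inj₂ e)) → inj₂ (inj₁ e) }
  third-element p≢q _ p≢r _ (inj₂ (inj₂ refl)) (inj₂ (inj₁ refl)) =
    _ , inj₁ refl , ≢-sym p≢r , ≢-sym p≢q ,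
    λ { (inj₁ e) → inj₂ (inj₂ e) ; (inj₂ (inj₁ e)) → inj₂ (inj₁ e) ; (inj₂ (inj₂ e)) → inj₁ e }

  related-side : ∀ {R : A → A → Set} {p q r a b} → Symmetric R →
    a ∈₃ (p , q , r) → b ∈₃ (p , q , r) → a ≢ b → R a b →
    R p q ⊎ R q r ⊎ R r p
  related-side _ (inj₁ refl) (inj₁ refl) a≢b _ = ⊥-elim (a≢b refl)
  related-side _ (inj₂ (inj₁ refl)) (inj₂ (inj₁ refl)) a≢b _ = ⊥-elim (a≢b refl)
  related-side _ (inj₂ (inj₂ refl)) (inj₂ (inj₂ refl)) a≢b _ = ⊥-elim (a≢b refl)
  related-side _   (inj₁ refl) (inj₂ (inj₁ refl)) _ Rab = inj₁ Rab
  related-side sym (inj₂ (inj₁ refl)) (inj₁ refl) _ Rab = inj₁ (sym Rab)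
  related-side _   (inj₂ (inj₁ refl)) (inj₂ (inj₂ refl)) _ Rab = inj₂ (inj₁ Rab)
  related-side sym (inj₂ (inj₂ refl)) (inj₂ (inj₁ refl)) _ Rab = inj₂ (inj₁ (sym Rab))
  related-side _   (inj₂ (inj₂ refl)) (inj₁ refl) _ Rab = inj₂ (inj₂ Rab)
  related-side sym (inj₁ refl) (inj₂ (inj₂ refl)) _ Rab = inj₂ (inj₂ (sym Rab))

ExactlyTwo : Set → Set → Set → Set
ExactlyTwo A B C = (A × B × ¬ C) ⊎ (B × C × ¬ A) ⊎ (C × A × ¬ B)

ExactlyTwo-rotate : ∀ {A B C} → ExactlyTwo A B C → ExactlyTwo B C A
ExactlyTwo-rotate (inj₁ abc) = inj₂ (inj₂ abc)
ExactlyTwo-rotate (inj₂ (inj₁ bca)) = inj₁ bca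
ExactlyTwo-rotate (inj₂ (inj₂ cab)) = inj₂ (inj₁ cab)

differs-from-exactly-one : ∀ {α γ : Bool} → α ≢ γ → ∀ β →
  (β ≢ α × β ≡ γ) ⊎ (β ≡ α × β ≢ γ)
differs-from-exactly-one {α} α≢γ β with β ≟ᵇ α
... | yes refl = inj₂ (refl , α≢γ)
... | no β≢α = inj₁ (β≢α , trans (¬-not β≢α) (sym (¬-not (≢-sym α≢γ))))

module _ (Γ : Triangulation) (T : IsTriangulation Γ) (t : ZOrientation Γ) where
  open Triangulation Γ
  open IsTriangulation T
  open ZOrientation t

  face-FaceVerts : ∀ i → let (p , q , r) = face i in FaceVerts Γ i p q r
  face-FaceVerts i =
    let (p≢q , q≢r , p≢r) = face-distinct i
    in p≢q , q≢r , p≢r , inj₁ refl , inj₂ (inj₁ refl) , inj₂ (inj₂ refl)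

  FaceVerts-rotate : ∀ {i a b c} → FaceVerts Γ i a b c → FaceVerts Γ i b c a
  FaceVerts-rotate (a≢b , b≢c , a≢c , a∈ , b∈ , c∈) = b≢c , ≢-sym a≢c , ≢-sym a≢b , b∈ , c∈ , a∈

  FaceVerts-swap : ∀ {i a b c} → FaceVerts Γ i a b c → FaceVerts Γ i b a c
  FaceVerts-swap (a≢b , b≢c , a≢c , a∈ , b∈ , c∈) = ≢-sym a≢b , a≢c , b≢c , b∈ , a∈ , c∈

  Flag-swap : ∀ {a b c} → Flag Γ a b c → Flag Γ b a c
  Flag-swap (i , F) = i , FaceVerts-swap F

  other-flag : ∀ {i x y z} → FaceVerts Γ i x y z → Σ (Fin n) λ d → Flag Γ x y d × d ≢ z
  other-flag {i} (x≢y , _ , _ , x∈i , y∈i , z∈i) with edge-two-faces i _ _ x≢y x∈i y∈i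
  ... | j , i≢j , x∈j , y∈j , _ with face-distinct j
  ... | p≢q , q≢r , p≢r with third-element p≢q q≢r p≢r x≢y x∈j y∈j
  ... | d , d∈j , x≢d , y≢d , j⊆xyd = d , (j , x≢y , y≢d , x≢d , x∈j , y∈j , d∈j) , d≢z
    where
    d≢z : d ≢ _
    d≢z refl = i≢j (sym (faces-distinct j i λ _ u∈j → ∈₃-⊆ x∈i y∈i z∈i (j⊆xyd u∈j)))

  τ-step : ∀ {x y z w} → Flag Γ x y z → Flag Γ y z w → w ≢ x → τ x y z ≡ τ y z w
  τ-step f g w≢x = τ-next _ _ _ _ (refl , refl , f , g , w≢x)

  τ-state : Fin n × Fin n × Fin n → Bool
  τ-state (x , y , z) = τ x y z

  reach-last-state : ∀ {i s v w} → Reach Γ i s (v , w) →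
    Σ (Fin n) λ u → Flag Γ u v w × τ-state s ≡ τ u v w ×
      (¬ InΩ Γ i (u , v) ⊎ (u , v) ≡ snd-edge Γ s)
  reach-last-state (stop (refl , refl , f , g , w≢x) _) = _ , g , τ-step f g w≢x , inj₂ refl
  reach-last-state (step (refl , refl , f , g , w≢x) ∉Ω r) with reach-last-state r
  ... | u , h , τ≡ , inj₁ u∉Ω = u , h , trans (τ-step f g w≢x) τ≡ , inj₁ u∉Ω
  ... | u , h , τ≡ , inj₂ refl = u , h , trans (τ-step f g w≢x) τ≡ , inj₁ ∉Ω

  -- The zigzag enters v → w from a state (u′ , v , w); u′ cannot be the third vertex u of F,
  -- since then u′ → v ∈ Ω(F) would be the starting edge x → y.  So (v , w , u) follows it.
  τ-monodromy : ∀ {i x y z v w u} → FaceVerts Γ i x y z → Monodromy Γ i x y z (v , w) →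
    FaceVerts Γ i v w u → v ≢ y → τ z x y ≡ τ v w u
  τ-monodromy {i} {u = u} _ m F@(_ , _ , _ , v∈i , _ , u∈i) v≢y with reach-last-state m
  ... | u′ , f , τ≡ , last with u ≟ u′
  ... | no u≢u′ = trans τ≡ (τ-step f (i , F) u≢u′)
  ... | yes refl with last
  ...   | inj₁ u∉Ω = ⊥-elim (u∉Ω (u∈i , v∈i))
  ...   | inj₂ refl = ⊥-elim (v≢y refl)

  EdgeTypeI-sym : ∀ {x y} → EdgeTypeI Γ t x y → EdgeTypeI Γ t y x
  EdgeTypeI-sym (z , z′ , f , f′ , τ≡ , τ≡′) = z′ , z , f′ , f , τ≡′ , τ≡

  -- x → y is traversed by the zigzags through (z , x , y) and (x , y , z), y → x by their reverses.
  ≢⇒EdgeTypeI : ∀ {i x y z} → FaceVerts Γ i x y z → τ x y z ≢ τ z x y → EdgeTypeI Γ t x y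
  ≢⇒EdgeTypeI {i} {x} {y} {z} F α≢γ with τ x y z in α≡
  ... | true = z , z , (i , F) , Flag-swap (i , F) , α≡ ,
    trans (τ-rev z x y zxy) (sym (¬-not α≢γ))
    where zxy = i , FaceVerts-rotate (FaceVerts-rotate F)
  ... | false with other-flag F
  ...   | d , xyd , d≢z = d , d , xyd , Flag-swap xyd ,
    trans (sym (τ-step zxy xyd d≢z)) (¬-not (≢-sym α≢γ)) ,
    trans (sym (τ-step (Flag-swap (i , FaceVerts-rotate F)) (Flag-swap xyd) d≢z))
          (trans (τ-rev x y z (i , F)) (cong not α≡))
    where zxy = i , FaceVerts-rotate (FaceVerts-rotate F)

  τ-on-edge : ∀ {i x y z w} → FaceVerts Γ i x y z → τ x y z ≡ τ z x y →
    Flag Γ x y w → τ x y w ≡ τ x y z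
  τ-on-edge {i} {z = z} {w} F α≡γ xyw with w ≟ z
  ... | yes refl = refl
  ... | no w≢z = trans (sym (τ-step (i , FaceVerts-rotate (FaceVerts-rotate F)) xyw w≢z)) (sym α≡γ)

  ≡⇒¬EdgeTypeI : ∀ {i x y z} → FaceVerts Γ i x y z → τ x y z ≡ τ z x y → ¬ EdgeTypeI Γ t x y
  ≡⇒¬EdgeTypeI {i} {x} {y} {z} F α≡γ (w , w′ , xyw , yxw′ , τxyw≡true , τyxw′≡true) =
    not-¬ refl (begin
      τ x y z         ≡⟨ sym (τ-on-edge F α≡γ xyw) ⟩
      τ x y w         ≡⟨ τxyw≡true ⟩
      true            ≡⟨ sym τyxw′≡true ⟩
      τ y x w′        ≡⟨ τ-on-edge (FaceVerts-swap F) yxz≡zyx yxw′ ⟩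
      τ y x z         ≡⟨ τ-rev z x y zxy ⟩
      not (τ z x y)   ≡⟨ cong not (sym α≡γ) ⟩
      not (τ x y z)   ∎)
    where
    open ≡-Reasoning
    zxy = i , FaceVerts-rotate (FaceVerts-rotate F)
    yxz≡zyx : τ y x z ≡ τ z y x
    yxz≡zyx = trans (τ-rev z x y zxy) (trans (cong not (sym α≡γ)) (sym (τ-rev x y z (i , F))))

  EdgeTypeI⇒ExactlyTwo : ∀ {i x y z} → FaceVerts Γ i x y z → EdgeTypeI Γ t x y →
    ExactlyTwo (EdgeTypeI Γ t x y) (EdgeTypeI Γ t y z) (EdgeTypeI Γ t z x)
  EdgeTypeI⇒ExactlyTwo {x = x} {y} {z} F xy
    with differs-from-exactly-one (λ α≡γ → ≡⇒¬EdgeTypeI F α≡γ xy) (τ y z x)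
  ... | inj₁ (β≢α , β≡γ) = inj₁ (xy , ≢⇒EdgeTypeI F′ β≢α , ≡⇒¬EdgeTypeI F″ (sym β≡γ))
    where F′ = FaceVerts-rotate F; F″ = FaceVerts-rotate F′
  ... | inj₂ (β≡α , β≢γ) = inj₂ (inj₂ (≢⇒EdgeTypeI F″ (≢-sym β≢γ) , xy , ≡⇒¬EdgeTypeI F′ β≡α))
    where F′ = FaceVerts-rotate F; F″ = FaceVerts-rotate F′

  EdgeTypeI⇒FaceTypeI : ∀ {i a b} → _∈F_ Γ a i → _∈F_ Γ b i → a ≢ b →
    EdgeTypeI Γ t a b → FaceTypeI Γ t i
  EdgeTypeI⇒FaceTypeI {i} a∈i b∈i a≢b ab with related-side EdgeTypeI-sym a∈i b∈i a≢b ab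
  ... | inj₁ pq = EdgeTypeI⇒ExactlyTwo F pq
    where F = face-FaceVerts i
  ... | inj₂ (inj₁ qr) = ExactlyTwo-rotate (ExactlyTwo-rotate (EdgeTypeI⇒ExactlyTwo F′ qr))
    where F′ = FaceVerts-rotate (face-FaceVerts i)
  ... | inj₂ (inj₂ rp) = ExactlyTwo-rotate (EdgeTypeI⇒ExactlyTwo F″ rp)
    where F″ = FaceVerts-rotate (FaceVerts-rotate (face-FaceVerts i))

  -- Only the arrow -e₁ ↦ e₃ of (M6) is needed.
  M6⇒EdgeTypeI : ∀ {i a b c} → FaceVerts Γ i a b c → Monodromy Γ i b a c (c , a) →
    EdgeTypeI Γ t a b
  M6⇒EdgeTypeI {i} {a} {b} {c} F@(_ , _ , a≢c , _) m =
    ≢⇒EdgeTypeI F λ α≡γ → not-¬ refl (trans α≡γ γ≡notα)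
    where
    F″ = FaceVerts-rotate (FaceVerts-rotate F)
    γ≡notα : τ c a b ≡ not (τ a b c)
    γ≡notα = trans (sym (τ-monodromy (FaceVerts-swap F) m F″ (≢-sym a≢c))) (τ-rev a b c (i , F))

proposition4 : (Γ : Triangulation) → IsTriangulation Γ →
    (i : Fin (Triangulation.m Γ)) → IsM6 Γ i →
    (t : ZOrientation Γ) → FaceTypeI Γ t i
proposition4 Γ T i (_ , _ , _ , F@(a≢b , _ , _ , a∈i , b∈i , _) , m , _) t =
  EdgeTypeI⇒FaceTypeI Γ T t a∈i b∈i a≢b (M6⇒EdgeTypeI Γ T t F m)
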